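{- Let $G$ be a connected graph with $n$ vertices and $n-2+\ell$ edges. Then $\mathrm{tw}(G)\le \ell$.
   Context: $\mathrm{tw}(G)$ denotes the treewidth of $G$. -}

module Defs where

open import Data.Nat using (ℕ; zero; suc; _+_; _≤_; _<_)
open import Data.Bool using (Bool; true; false; T; if_then_else_; _∧_)
open import Data.Fin using (Fin; zero; suc; toℕ; _<?_)
open import Data.Fin.Subset using (Subset; _∈_; ∣_∣)
open import Data.List using (List; map; allFin)
open import Data.Nat.ListAction using (sum)
open import Data.Product using (Σ; ∃; _×_; _,_)
open import Data.Sum using (_⊎_)
open import Data.Unit using (⊤)
open import Relation.Nullary.Decidable using (⌊_⌋)
open import Relation.Binary.PropositionalEquality using (_≡_)

data WalkIn {A : Set} (R : A → A → Set) (P : A → Set) : A → A → Set where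
  here : ∀ {a} → P a → WalkIn R P a a
  step : ∀ {a b c} → P a → R a b → WalkIn R P b c → WalkIn R P a c

record Graph (n : ℕ) : Set where
  field
    adj   : Fin n → Fin n → Bool
    sym   : ∀ i j → adj i j ≡ adj j i
    irrefl : ∀ i → adj i i ≡ false
open Graph public

Adj : ∀ {n} → Graph n → Fin n → Fin n → Set
Adj G i j = T (adj G i j)

edgeCount : ∀ {n} → Graph n → ℕ
edgeCount {n} G =
  sum (map (λ i → sum (map (λ j → if ⌊ i <? j ⌋ ∧ adj G i j then 1 else 0)
                           (allFin n)))
           (allFin n))

Connected : ∀ {n} → Graph n → Set
Connected {n} G = Fin n × (∀ u v → WalkIn (Adj G) (λ _ → ⊤) u v)

-- A tree on node set Fin (suc t): node (suc i) is attached to its parent,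
-- which has smaller index (every finite tree arises this way).
record Tree (t : ℕ) : Set where
  field
    parent    : Fin t → Fin (suc t)
    parent-lt : ∀ i → toℕ (parent i) ≤ toℕ i
open Tree public

TreeAdj : ∀ {t} → Tree t → Fin (suc t) → Fin (suc t) → Set
TreeAdj T a b = (∃ λ i → a ≡ suc i × b ≡ parent T i)
              ⊎ (∃ λ i → b ≡ suc i × a ≡ parent T i)

record TreeDecomposition {n : ℕ} (G : Graph n) : Set where
  field
    t       : ℕ
    tree    : Tree t
    bag     : Fin (suc t) → Subset n
    covers-vertices : ∀ v → ∃ λ x → v ∈ bag x
    covers-edges    : ∀ u v → Adj G u v → ∃ λ x → (u ∈ bag x × v ∈ bag x)
    connected-bags  : ∀ v x y → v ∈ bag x → v ∈ bag y →
                      WalkIn (TreeAdj tree) (λ z → v ∈ bag z) x y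
open TreeDecomposition public

HasWidthAtMost : ∀ {n} {G : Graph n} → TreeDecomposition G → ℕ → Set
HasWidthAtMost D k = ∀ x → ∣ bag D x ∣ ≤ suc k

TreewidthAtMost : ∀ {n} → Graph n → ℕ → Set
TreewidthAtMost G k = Σ (TreeDecomposition G) λ D → HasWidthAtMost D k

{-# OPTIONS --safe #-}
-- Root a breadth-first spanning tree at vertex 0 and number the vertices by (distance, index),
-- so that every non-root vertex comes after its tree parent. Call v a late end if it has an
-- earlier neighbour other than its parent, and let S be the set of late ends. Counting every
-- edge at its later end, each non-root vertex contributes its parent edge and each vertex of S
-- one more edge, so |S| + (n - 1) ≤ m = n - 2 + ℓ. A tree decomposition shaped like the
-- spanning tree, with bags S ∪ {v, parent v}, therefore has width at most |S| + 1 ≤ ℓ.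
module Submission where

open import Defs hiding (sym)
open import Data.Nat using (ℕ; zero; suc; _+_; _*_; _≤_; _<_; z≤n; s≤s)
open import Data.Nat.Properties
  using (+-0-commutativeMonoid; ≤-refl; ≤-trans; ≤-reflexive; ≤-pred; ≮⇒≥; n≤0⇒n≡0; m≤m+n;
         n≤1+n; n≮0; +-suc; +-mono-≤; +-monoʳ-≤; +-monoˡ-≤; module ≤-Reasoning; +-assoc; +-comm; +-cancelʳ-≤;
         *-cancelˡ-≡; +-identityʳ; anyUpTo?)
open import Data.Nat.Induction using (<-rec)
import Data.Nat.ListAction as List
open import Algebra.Properties.CommutativeMonoid.Sum +-0-commutativeMonoid
  using (sum-syntax; ∑-distrib-+; ∑-comm; sum-cong-≗; sum-remove)
open import Data.Bool using (Bool; true; false; T; if_then_else_; _∧_)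
open import Data.Bool.Properties using (∧-zeroʳ)
open import Data.Fin using (Fin; zero; suc; toℕ; fromℕ<; combine; _<?_)
import Data.Fin.Properties as Fin
open import Data.Fin.Subset using (Subset; _∈_; ∣_∣; ⁅_⁆; _∪_; _⊆_) renaming (⊥ to ∅)
open import Data.Fin.Subset.Properties
  using (x∈⁅x⁆; x∈⁅y⁆⇒x≡y; ∣⁅x⁆∣≡1; x∈p∪q⁺; x∈p∪q⁻; ∉⊥; ∣⊥∣≡0; p⊆q⇒∣p∣≤∣q∣; p⊂q⇒∣p∣<∣q∣)
open import Data.List using (map; allFin; tabulate)
open import Data.List.Properties using (map-tabulate)
import Data.Vec as Vec
open import Data.Vec.Properties using (lookup⇒[]=; lookup∘tabulate)
open import Data.Product using (Σ; ∃; _×_; _,_; proj₁; proj₂)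
open import Data.Sum as Sum using (_⊎_; inj₁; inj₂)
open import Data.Unit using (⊤)
open import Data.Empty using (⊥-elim)
open import Function using (_∘_; id)
open import Function.Definitions using (Injective)
open import Relation.Binary using (Symmetric; tri<; tri≈; tri>)
open import Relation.Binary.PropositionalEquality
open import Relation.Nullary using (¬_; Dec; yes; no; ¬?)
open import Relation.Nullary.Decidable using (⌊_⌋; isYes≗does; dec-true; dec-false; _×-dec_; _⊎-dec_; T?)
open import Relation.Unary using (Decidable)

𝟙 : Bool → ℕ
𝟙 b = if b then 1 else 0

∑-mono-≤ : ∀ {n} {f g : Fin n → ℕ} → (∀ i → f i ≤ g i) → ∑[ i < n ] f i ≤ ∑[ i < n ] g i
∑-mono-≤ {zero}  _   = z≤n
∑-mono-≤ {suc n} f≤g = +-mono-≤ (f≤g zero) (∑-mono-≤ (f≤g ∘ suc))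

∑-one : ∀ n → ∑[ i < n ] 1 ≡ n
∑-one zero    = refl
∑-one (suc n) = cong suc (∑-one n)

term≤∑ : ∀ {n} (f : Fin n → ℕ) i → f i ≤ ∑[ j < n ] f j
term≤∑ {suc n} f i = ≤-trans (m≤m+n (f i) _) (≤-reflexive (sym (sum-remove {i = i} f)))

list-sum-tabulate : ∀ {n} (f : Fin n → ℕ) → List.sum (tabulate f) ≡ ∑[ i < n ] f i
list-sum-tabulate {zero}  f = refl
list-sum-tabulate {suc n} f = cong (f zero +_) (list-sum-tabulate (f ∘ suc))

list-sum-allFin : ∀ {n} (f : Fin n → ℕ) → List.sum (map f (allFin n)) ≡ ∑[ i < n ] f i
list-sum-allFin f = trans (cong List.sum (map-tabulate id f)) (list-sum-tabulate f)

toSubset : ∀ {n} {P : Fin n → Set} → Decidable P → Subset n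
toSubset P? = Vec.tabulate (λ i → ⌊ P? i ⌋)

∈-toSubset⁺ : ∀ {n} {P : Fin n → Set} (P? : Decidable P) {i} → P i → i ∈ toSubset P?
∈-toSubset⁺ P? {i} p =
  lookup⇒[]= i _ (trans (lookup∘tabulate _ i) (trans (isYes≗does (P? i)) (dec-true (P? i) p)))

∣tabulate∣ : ∀ {n} (f : Fin n → Bool) → ∣ Vec.tabulate f ∣ ≡ ∑[ i < n ] 𝟙 (f i)
∣tabulate∣ {zero}  f = refl
∣tabulate∣ {suc n} f with f zero
... | true  = cong suc (∣tabulate∣ (f ∘ suc))
... | false = ∣tabulate∣ (f ∘ suc)

∣toSubset∣ : ∀ {n} {P : Fin n → Set} (P? : Decidable P) → ∣ toSubset P? ∣ ≡ ∑[ i < n ] 𝟙 ⌊ P? i ⌋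
∣toSubset∣ P? = ∣tabulate∣ (λ i → ⌊ P? i ⌋)

∣p∪q∣≤∣p∣+∣q∣ : ∀ {n} (p q : Subset n) → ∣ p ∪ q ∣ ≤ ∣ p ∣ + ∣ q ∣
∣p∪q∣≤∣p∣+∣q∣ Vec.[]            Vec.[]            = z≤n
∣p∪q∣≤∣p∣+∣q∣ (true  Vec.∷ p) (true  Vec.∷ q) =
  s≤s (≤-trans (∣p∪q∣≤∣p∣+∣q∣ p q) (+-monoʳ-≤ ∣ p ∣ (n≤1+n ∣ q ∣)))
∣p∪q∣≤∣p∣+∣q∣ (true  Vec.∷ p) (false Vec.∷ q) = s≤s (∣p∪q∣≤∣p∣+∣q∣ p q)
∣p∪q∣≤∣p∣+∣q∣ (false Vec.∷ p) (true  Vec.∷ q) =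
  ≤-trans (s≤s (∣p∪q∣≤∣p∣+∣q∣ p q)) (≤-reflexive (sym (+-suc ∣ p ∣ ∣ q ∣)))
∣p∪q∣≤∣p∣+∣q∣ (false Vec.∷ p) (false Vec.∷ q) = ∣p∪q∣≤∣p∣+∣q∣ p q

x∈p⇒⁅x⁆⊆p : ∀ {n} {x : Fin n} {p} → x ∈ p → ⁅ x ⁆ ⊆ p
x∈p⇒⁅x⁆⊆p {x = x} {p} x∈p y∈⁅x⁆ = subst (_∈ p) (sym (x∈⁅y⁆⇒x≡y x y∈⁅x⁆)) x∈p

x∈p⇒1≤∣p∣ : ∀ {n} {x : Fin n} {p} → x ∈ p → 1 ≤ ∣ p ∣
x∈p⇒1≤∣p∣ {x = x} x∈p = subst (_≤ _) (∣⁅x⁆∣≡1 x) (p⊆q⇒∣p∣≤∣q∣ (x∈p⇒⁅x⁆⊆p x∈p))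

x,y∈p⇒2≤∣p∣ : ∀ {n} {x y : Fin n} {p} → x ∈ p → y ∈ p → x ≢ y → 2 ≤ ∣ p ∣
x,y∈p⇒2≤∣p∣ {x = x} {y} x∈p y∈p x≢y =
  subst (_< _) (∣⁅x⁆∣≡1 x) (p⊂q⇒∣p∣<∣q∣ (x∈p⇒⁅x⁆⊆p x∈p , y , y∈p , x≢y ∘ sym ∘ x∈⁅y⁆⇒x≡y x))

⌊⌋-×-T? : ∀ {A : Set} (a? : Dec A) b → ⌊ a? ×-dec T? b ⌋ ≡ ⌊ a? ⌋ ∧ b
⌊⌋-×-T? (yes _) true  = refl
⌊⌋-×-T? (yes _) false = refl
⌊⌋-×-T? (no _)  _     = refl

module _ {P : ℕ → Set} (P? : Decidable P) where

  least-witness : ∀ {m} → P m → Σ ℕ λ k → P k × (∀ {j} → j < k → ¬ P j)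
  least-witness {m} = <-rec (λ m → P m → Σ ℕ λ k → P k × (∀ {j} → j < k → ¬ P j)) search m
    where
    search : ∀ m → (∀ {j} → j < m → P j → Σ ℕ λ k → P k × (∀ {i} → i < k → ¬ P i)) →
             P m → Σ ℕ λ k → P k × (∀ {j} → j < k → ¬ P j)
    search m smaller pm with anyUpTo? P? m
    ... | yes (j , j<m , pj) = smaller j<m pj
    ... | no none            = m , pm , λ j<m pj → none (_ , j<m , pj)

module _ {A : Set} {R : A → A → Set} {P : A → Set} where

  _++ᵂ_ : ∀ {a b c} → WalkIn R P a b → WalkIn R P b c → WalkIn R P a c
  here _       ++ᵂ w′ = w′
  step p r w   ++ᵂ w′ = step p r (w ++ᵂ w′)

  walk-start : ∀ {a b} → WalkIn R P a b → P a
  walk-start (here p)     = p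
  walk-start (step p _ _) = p

  reverseᵂ : Symmetric R → ∀ {a b} → WalkIn R P a b → WalkIn R P b a
  reverseᵂ R-sym (here p)       = here p
  reverseᵂ R-sym (step p r w) = reverseᵂ R-sym w ++ᵂ step (walk-start w) (R-sym r) (here p)

TreeAdj-sym : ∀ {t} (T : Tree t) → Symmetric (TreeAdj T)
TreeAdj-sym T = Sum.swap

module _ {t} (T : Tree t) {P : Fin (suc t) → Set} (P-all : ∀ x → P x) where

  walk-to-root : ∀ x → WalkIn (TreeAdj T) P x zero
  walk-to-root x = climb (toℕ x) x ≤-refl
    where
    climb : ∀ m x → toℕ x ≤ m → WalkIn (TreeAdj T) P x zero
    climb _       zero    _          = here (P-all zero)
    climb (suc m) (suc i) (s≤s i≤m) =
      step (P-all (suc i)) (inj₁ (i , refl , refl)) (climb m (parent T i) (≤-trans (parent-lt T i) i≤m))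

  tree-walk : ∀ x y → WalkIn (TreeAdj T) P x y
  tree-walk x y = walk-to-root x ++ᵂ reverseᵂ (TreeAdj-sym T) (walk-to-root y)

module _ {n} (G : Graph n) where

  Adj-sym : Symmetric (Adj G)
  Adj-sym {u} {v} = subst T (Graph.sym G u v)

  Adj⇒≢ : ∀ {u v} → Adj G u v → u ≢ v
  Adj⇒≢ {u} uv refl = subst T (irrefl G u) uv

  rankedEdgeCount : ∀ {m} → (Fin n → Fin m) → ℕ
  rankedEdgeCount k = ∑[ u < n ] ∑[ v < n ] 𝟙 (⌊ k u <? k v ⌋ ∧ adj G u v)

  degreeSum : ℕ
  degreeSum = ∑[ u < n ] ∑[ v < n ] 𝟙 (adj G u v)

  module _ {m} (k : Fin n → Fin m) (k-injective : Injective _≡_ _≡_ k) where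

    𝟙-adj-split : ∀ u v → 𝟙 (adj G u v) ≡
                            𝟙 (⌊ k u <? k v ⌋ ∧ adj G u v) + 𝟙 (⌊ k v <? k u ⌋ ∧ adj G u v)
    𝟙-adj-split u v with adj G u v in uv
    ... | false =
      sym (cong₂ _+_ (cong 𝟙 (∧-zeroʳ ⌊ k u <? k v ⌋)) (cong 𝟙 (∧-zeroʳ ⌊ k v <? k u ⌋)))
    ... | true with Fin.<-cmp (k u) (k v)
    ...   | tri< ku<kv _ kv≮ku
      rewrite isYes≗does (k u <? k v) | dec-true (k u <? k v) ku<kv
            | isYes≗does (k v <? k u) | dec-false (k v <? k u) kv≮ku = refl
    ...   | tri> ku≮kv _ kv<ku
      rewrite isYes≗does (k u <? k v) | dec-false (k u <? k v) ku≮kv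
            | isYes≗does (k v <? k u) | dec-true (k v <? k u) kv<ku = refl
    ...   | tri≈ _ ku≡kv _ = ⊥-elim (Adj⇒≢ (subst T (sym uv) _) (k-injective ku≡kv))

    degreeSum≡2×rankedEdgeCount : degreeSum ≡ rankedEdgeCount k + rankedEdgeCount k
    degreeSum≡2×rankedEdgeCount = begin
      degreeSum
        ≡⟨ sum-cong-≗ (λ u → trans (sum-cong-≗ (𝟙-adj-split u)) (∑-distrib-+ (earlier u) (later u))) ⟩
      ∑[ u < n ] (∑[ v < n ] earlier u v + ∑[ v < n ] later u v)
        ≡⟨ ∑-distrib-+ (λ u → ∑[ v < n ] earlier u v) (λ u → ∑[ v < n ] later u v) ⟩
      rankedEdgeCount k + ∑[ u < n ] ∑[ v < n ] later u v
        ≡⟨ cong (rankedEdgeCount k +_) (∑-comm later) ⟩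
      rankedEdgeCount k + ∑[ v < n ] ∑[ u < n ] later u v
        ≡⟨ cong (rankedEdgeCount k +_) (sum-cong-≗ λ v → sum-cong-≗ λ u →
                  cong (λ b → 𝟙 (⌊ k v <? k u ⌋ ∧ b)) (Graph.sym G u v)) ⟩
      rankedEdgeCount k + rankedEdgeCount k ∎
      where
      open ≡-Reasoning
      earlier later : Fin n → Fin n → ℕ
      earlier u v = 𝟙 (⌊ k u <? k v ⌋ ∧ adj G u v)
      later   u v = 𝟙 (⌊ k v <? k u ⌋ ∧ adj G u v)

  edgeCount≡rankedEdgeCount : ∀ {m} (k : Fin n → Fin m) → Injective _≡_ _≡_ k →
                              edgeCount G ≡ rankedEdgeCount k
  -- Both sides are half of the degree sum.
  edgeCount≡rankedEdgeCount k k-injective = *-cancelˡ-≡ _ _ 2 (begin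
    2 * edgeCount G                          ≡⟨ cong (2 *_) edgeCount≡rankedEdgeCount-id ⟩
    2 * rankedEdgeCount id                   ≡⟨ double (rankedEdgeCount id) ⟩
    rankedEdgeCount id + rankedEdgeCount id  ≡⟨ sym (degreeSum≡2×rankedEdgeCount id id) ⟩
    degreeSum                                ≡⟨ degreeSum≡2×rankedEdgeCount k k-injective ⟩
    rankedEdgeCount k + rankedEdgeCount k    ≡⟨ sym (double (rankedEdgeCount k)) ⟩
    2 * rankedEdgeCount k                    ∎)
    where
    open ≡-Reasoning
    edge : Fin n → Fin n → ℕ
    edge u v = 𝟙 (⌊ u <? v ⌋ ∧ adj G u v)
    edgeCount≡rankedEdgeCount-id : edgeCount G ≡ rankedEdgeCount id
    edgeCount≡rankedEdgeCount-id =
      trans (list-sum-allFin (λ u → List.sum (map (edge u) (allFin n))))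
            (sum-cong-≗ (list-sum-allFin ∘ edge))
    double : ∀ a → 2 * a ≡ a + a
    double a = cong (a +_) (+-identityʳ a)

record OrderedSpanningTree {n′} (G : Graph (suc n′)) (t : ℕ) : Set where
  field
    rank             : Fin (suc n′) → Fin (suc t)
    rank-injective   : Injective _≡_ _≡_ rank
    rank-root        : rank zero ≡ zero
    predecessor      : Fin n′ → Fin (suc n′)
    predecessor-adj  : ∀ v → Adj G (predecessor v) (suc v)
    predecessor-rank : ∀ v → toℕ (rank (predecessor v)) < toℕ (rank (suc v))

module BreadthFirst {n′} (G : Graph (suc n′))
                    (walk : ∀ v → WalkIn (Adj G) (λ _ → ⊤) zero v) where

  Reach : ℕ → Fin (suc n′) → Set
  Reach zero    v = v ≡ zero
  Reach (suc k) v = Reach k v ⊎ ∃ λ u → Reach k u × Adj G u v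

  reach? : ∀ k → Decidable (Reach k)
  reach? zero    v = v Fin.≟ zero
  reach? (suc k) v = reach? k v ⊎-dec Fin.any? (λ u → reach? k u ×-dec T? (adj G u v))

  walk-reach : ∀ {P k a b} → Reach k a → WalkIn (Adj G) P a b → ∃ λ j → Reach j b
  walk-reach r (here _)     = _ , r
  walk-reach r (step _ a w) = walk-reach (inj₂ (_ , r , a)) w

  nearest : ∀ v → Σ ℕ λ k → Reach k v × (∀ {j} → j < k → ¬ Reach j v)
  nearest v = least-witness (λ k → reach? k v) (proj₂ (walk-reach refl (walk v)))

  dist : Fin (suc n′) → ℕ
  dist v = proj₁ (nearest v)

  dist-least : ∀ {j v} → Reach j v → dist v ≤ j
  dist-least {v = v} r = ≮⇒≥ λ j<dist → proj₂ (proj₂ (nearest v)) j<dist r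

  dist-root : dist zero ≡ 0
  dist-root = n≤0⇒n≡0 (dist-least refl)

  closer-neighbour : ∀ v → ∃ λ u → Adj G u (suc v) × dist u < dist (suc v)
  closer-neighbour v = let k , r , minimal = nearest (suc v) in descend k r minimal
    where
    descend : ∀ k → Reach k (suc v) → (∀ {j} → j < k → ¬ Reach j (suc v)) →
              ∃ λ u → Adj G u (suc v) × dist u < k
    descend zero    ()                    _
    descend (suc k) (inj₁ r)              minimal = ⊥-elim (minimal ≤-refl r)
    descend (suc k) (inj₂ (u , r , u~v)) _       = u , u~v , s≤s (dist-least r)

  -- Any common bound on the distances would do.
  distBound : ℕ
  distBound = ∑[ v < suc n′ ] dist v

  level : Fin (suc n′) → Fin (suc distBound)
  level v = fromℕ< (s≤s (term≤∑ dist v))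

  level-< : ∀ {u v} → dist u < dist v → toℕ (level u) < toℕ (level v)
  level-< = subst₂ _<_ (sym (Fin.toℕ-fromℕ< _)) (sym (Fin.toℕ-fromℕ< _))

  level-root : level zero ≡ zero
  level-root = Fin.toℕ-injective (trans (Fin.toℕ-fromℕ< _) dist-root)

  spanningTree : OrderedSpanningTree G (n′ + distBound * suc n′)
  spanningTree = record
    { rank             = λ v → combine (level v) v
    ; rank-injective   = λ {u} {v} e → proj₂ (Fin.combine-injective (level u) u (level v) v e)
    ; rank-root        = cong (λ l → combine {n = suc n′} l zero) level-root
    ; predecessor      = proj₁ ∘ closer-neighbour
    ; predecessor-adj  = proj₁ ∘ proj₂ ∘ closer-neighbour
    ; predecessor-rank = λ v →
        Fin.combine-monoˡ-< _ (suc v) (level-< (proj₂ (proj₂ (closer-neighbour v))))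
    }

module SpanningTreeDecomposition {n′ t} {G : Graph (suc n′)} (T : OrderedSpanningTree G t) where
  open OrderedSpanningTree T

  up : Fin (suc n′) → Fin (suc n′)
  up zero    = zero
  up (suc v) = predecessor v

  LateEnd : Fin (suc n′) → Set
  LateEnd v = ∃ λ u → toℕ (rank u) < toℕ (rank v) × Adj G u v × u ≢ up v

  lateEnd? : Decidable LateEnd
  lateEnd? v = Fin.any? λ u → (rank u <? rank v) ×-dec T? (adj G u v) ×-dec ¬? (u Fin.≟ up v)

  lateEnds : Subset (suc n′)
  lateEnds = toSubset lateEnd?

  Owner : Fin (suc t) → Set
  Owner x = ∃ λ w → rank w ≡ x

  owner? : Decidable Owner
  owner? x = Fin.any? λ w → rank w Fin.≟ x

  rank-suc : ∀ v → ∃ λ i → rank (suc v) ≡ suc i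
  rank-suc v with rank (suc v) in e
  ... | zero  = ⊥-elim (Fin.0≢1+n (rank-injective (trans rank-root (sym e))))
  ... | suc i = i , refl

  -- Tree nodes that are not ranks of vertices hang below the root with bag lateEnds.
  treeParent : (i : Fin t) → Dec (Owner (suc i)) → Fin (suc t)
  treeParent i (yes (w , _)) = rank (up w)
  treeParent i (no _)        = zero

  treeParent-≤ : ∀ i d → toℕ (treeParent i d) ≤ toℕ i
  treeParent-≤ i (yes (zero , e))  = ⊥-elim (Fin.0≢1+n (trans (sym rank-root) e))
  treeParent-≤ i (yes (suc w , e)) =
    ≤-pred (subst (λ x → toℕ (rank (predecessor w)) < toℕ x) e (predecessor-rank w))
  treeParent-≤ i (no _)            = z≤n

  treeParent-owner : ∀ {i w} → rank w ≡ suc i → (d : Dec (Owner (suc i))) →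
                     treeParent i d ≡ rank (up w)
  treeParent-owner e (yes (w′ , e′)) = cong (rank ∘ up) (rank-injective (trans e′ (sym e)))
  treeParent-owner e (no unowned)    = ⊥-elim (unowned (_ , e))

  decompositionTree : Tree t
  decompositionTree = record
    { parent    = λ i → treeParent i (owner? (suc i))
    ; parent-lt = λ i → treeParent-≤ i (owner? (suc i))
    }

  ownBag : ∀ {x} → Dec (Owner x) → Subset (suc n′)
  ownBag (yes (w , _)) = ⁅ w ⁆ ∪ ⁅ up w ⁆
  ownBag (no _)        = ∅

  bagOf : Fin (suc t) → Subset (suc n′)
  bagOf x = lateEnds ∪ ownBag (owner? x)

  ∣ownBag∣≤2 : ∀ {x} (d : Dec (Owner x)) → ∣ ownBag d ∣ ≤ 2
  ∣ownBag∣≤2 (yes (w , _)) =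
    subst₂ (λ a b → ∣ ⁅ w ⁆ ∪ ⁅ up w ⁆ ∣ ≤ a + b) (∣⁅x⁆∣≡1 w) (∣⁅x⁆∣≡1 (up w))
           (∣p∪q∣≤∣p∣+∣q∣ ⁅ w ⁆ ⁅ up w ⁆)
  ∣ownBag∣≤2 (no _)        = ≤-trans (≤-reflexive (∣⊥∣≡0 (suc n′))) z≤n

  ∣bagOf∣≤ : ∀ x → ∣ bagOf x ∣ ≤ ∣ lateEnds ∣ + 2
  ∣bagOf∣≤ x = ≤-trans (∣p∪q∣≤∣p∣+∣q∣ lateEnds (ownBag (owner? x)))
                       (+-monoʳ-≤ ∣ lateEnds ∣ (∣ownBag∣≤2 (owner? x)))

  ∈-bagOf-late : ∀ {v} x → v ∈ lateEnds → v ∈ bagOf x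
  ∈-bagOf-late x late = x∈p∪q⁺ (inj₁ late)

  ∈-bagOf-rank : ∀ {v} w → v ≡ w ⊎ v ≡ up w → v ∈ bagOf (rank w)
  ∈-bagOf-rank {v} w v∈edge = x∈p∪q⁺ (inj₂ (own (owner? (rank w))))
    where
    own : (d : Dec (Owner (rank w))) → v ∈ ownBag d
    own (yes (w′ , e)) rewrite rank-injective e =
      x∈p∪q⁺ (Sum.map (λ { refl → x∈⁅x⁆ w }) (λ { refl → x∈⁅x⁆ (up w) }) v∈edge)
    own (no unowned) = ⊥-elim (unowned (w , refl))

  ∈-bagOf⁻ : ∀ {v} x → v ∈ bagOf x → v ∈ lateEnds ⊎ ∃ λ w → rank w ≡ x × (v ≡ w ⊎ v ≡ up w)
  ∈-bagOf⁻ x v∈ = Sum.map₂ (own (owner? x)) (x∈p∪q⁻ lateEnds (ownBag (owner? x)) v∈)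
    where
    own : ∀ {v} (d : Dec (Owner x)) → v ∈ ownBag d → ∃ λ w → rank w ≡ x × (v ≡ w ⊎ v ≡ up w)
    own (yes (w , e)) v∈ =
      w , e , Sum.map (x∈⁅y⁆⇒x≡y w) (x∈⁅y⁆⇒x≡y (up w)) (x∈p∪q⁻ ⁅ w ⁆ ⁅ up w ⁆ v∈)
    own (no _)        v∈ = ⊥-elim (∉⊥ v∈)

  covered-forward : ∀ {u v} → Adj G u v → toℕ (rank u) < toℕ (rank v) →
                    ∃ λ x → u ∈ bagOf x × v ∈ bagOf x
  covered-forward {u} {v} u~v u<v with u Fin.≟ up v
  ... | yes u≡up = rank v , ∈-bagOf-rank v (inj₂ u≡up) , ∈-bagOf-rank v (inj₁ refl)
  ... | no u≢up  = rank u , ∈-bagOf-rank u (inj₁ refl)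
                          , ∈-bagOf-late (rank u) (∈-toSubset⁺ lateEnd? (u , u<v , u~v , u≢up))

  covered : ∀ u v → Adj G u v → ∃ λ x → u ∈ bagOf x × v ∈ bagOf x
  covered u v u~v with Fin.<-cmp (rank u) (rank v)
  ... | tri< u<v _ _ = covered-forward u~v u<v
  ... | tri≈ _ e _   = ⊥-elim (Adj⇒≢ G u~v (rank-injective e))
  ... | tri> _ _ v<u = let x , v∈ , u∈ = covered-forward (Adj-sym G u~v) v<u in x , u∈ , v∈

  walk-to-own-rank : ∀ {v} w → v ≡ w ⊎ v ≡ up w →
                     WalkIn (TreeAdj decompositionTree) (λ z → v ∈ bagOf z) (rank w) (rank v)
  walk-to-own-rank w       (inj₁ refl) = here (∈-bagOf-rank w (inj₁ refl))
  walk-to-own-rank zero    (inj₂ refl) = here (∈-bagOf-rank zero (inj₁ refl))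
  walk-to-own-rank (suc w) (inj₂ refl) =
    step (∈-bagOf-rank (suc w) (inj₂ refl)) tree-edge (here (∈-bagOf-rank (predecessor w) (inj₁ refl)))
    where
    i = proj₁ (rank-suc w)
    tree-edge : TreeAdj decompositionTree (rank (suc w)) (rank (predecessor w))
    tree-edge = inj₁ (i , proj₂ (rank-suc w) ,
                      sym (treeParent-owner (proj₂ (rank-suc w)) (owner? (suc i))))

  bags-connected : ∀ v x y → v ∈ bagOf x → v ∈ bagOf y →
                   WalkIn (TreeAdj decompositionTree) (λ z → v ∈ bagOf z) x y
  bags-connected v x y v∈x v∈y with ∈-bagOf⁻ x v∈x | ∈-bagOf⁻ y v∈y
  ... | inj₁ late | _ = tree-walk decompositionTree (λ z → ∈-bagOf-late z late) x y
  ... | _ | inj₁ late = tree-walk decompositionTree (λ z → ∈-bagOf-late z late) x y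
  ... | inj₂ (w₁ , refl , v∈₁) | inj₂ (w₂ , refl , v∈₂) =
    walk-to-own-rank w₁ v∈₁ ++ᵂ reverseᵂ (TreeAdj-sym decompositionTree) (walk-to-own-rank w₂ v∈₂)

  decomposition : TreeDecomposition G
  decomposition = record
    { t               = t
    ; tree            = decompositionTree
    ; bag             = bagOf
    ; covers-vertices = λ v → rank v , ∈-bagOf-rank v (inj₁ refl)
    ; covers-edges    = covered
    ; connected-bags  = bags-connected
    }

  earlier? : ∀ v → Decidable λ u → toℕ (rank u) < toℕ (rank v) × Adj G u v
  earlier? v u = (rank u <? rank v) ×-dec T? (adj G u v)

  earlierNeighbours : Fin (suc n′) → Subset (suc n′)
  earlierNeighbours v = toSubset (earlier? v)

  ∣earlierNeighbours∣ : ∀ v → ∣ earlierNeighbours v ∣ ≡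
                              ∑[ u < suc n′ ] 𝟙 (⌊ rank u <? rank v ⌋ ∧ adj G u v)
  ∣earlierNeighbours∣ v = trans (∣toSubset∣ (earlier? v))
    (sum-cong-≗ λ u → cong 𝟙 (⌊⌋-×-T? (rank u <? rank v) (adj G u v)))

  predecessor-earlier : ∀ v → predecessor v ∈ earlierNeighbours (suc v)
  predecessor-earlier v = ∈-toSubset⁺ (earlier? (suc v)) (predecessor-rank v , predecessor-adj v)

  nonRoot : Fin (suc n′) → ℕ
  nonRoot zero    = 0
  nonRoot (suc _) = 1

  late+nonRoot≤∣earlierNeighbours∣ : ∀ v → 𝟙 ⌊ lateEnd? v ⌋ + nonRoot v ≤ ∣ earlierNeighbours v ∣
  late+nonRoot≤∣earlierNeighbours∣ zero with lateEnd? zero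
  ... | yes (u , u<root , _) = ⊥-elim (n≮0 (subst (λ r → toℕ (rank u) < toℕ r) rank-root u<root))
  ... | no _                 = z≤n
  late+nonRoot≤∣earlierNeighbours∣ (suc v) with lateEnd? (suc v)
  ... | yes (u , u<v , u~v , u≢pred) =
        x,y∈p⇒2≤∣p∣ (predecessor-earlier v) (∈-toSubset⁺ (earlier? (suc v)) (u<v , u~v)) (u≢pred ∘ sym)
  ... | no _ = x∈p⇒1≤∣p∣ (predecessor-earlier v)

  ∣lateEnds∣+n′≤edgeCount : ∣ lateEnds ∣ + n′ ≤ edgeCount G
  ∣lateEnds∣+n′≤edgeCount = begin
    ∣ lateEnds ∣ + n′
      ≡⟨ cong₂ _+_ (∣toSubset∣ lateEnd?) (sym (∑-one n′)) ⟩
    ∑[ v < suc n′ ] 𝟙 ⌊ lateEnd? v ⌋ + ∑[ v < suc n′ ] nonRoot v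
      ≡⟨ sym (∑-distrib-+ (λ v → 𝟙 ⌊ lateEnd? v ⌋) nonRoot) ⟩
    ∑[ v < suc n′ ] (𝟙 ⌊ lateEnd? v ⌋ + nonRoot v)
      ≤⟨ ∑-mono-≤ late+nonRoot≤∣earlierNeighbours∣ ⟩
    ∑[ v < suc n′ ] ∣ earlierNeighbours v ∣
      ≡⟨ sum-cong-≗ ∣earlierNeighbours∣ ⟩
    ∑[ v < suc n′ ] ∑[ u < suc n′ ] 𝟙 (⌊ rank u <? rank v ⌋ ∧ adj G u v)
      ≡⟨ ∑-comm (λ v u → 𝟙 (⌊ rank u <? rank v ⌋ ∧ adj G u v)) ⟩
    rankedEdgeCount G rank
      ≡⟨ sym (edgeCount≡rankedEdgeCount G rank rank-injective) ⟩
    edgeCount G ∎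
    where open ≤-Reasoning

mainTheorem18 : (n ℓ : ℕ) (G : Graph n) → Connected G →
                edgeCount G + 2 ≡ n + ℓ → TreewidthAtMost G ℓ
mainTheorem18 zero       ℓ G (() , _)   _
mainTheorem18 (suc n′) ℓ G (_ , walk) m+2≡n+ℓ =
  decomposition , λ x → ≤-trans (∣bagOf∣≤ x) ∣lateEnds∣+2≤1+ℓ
  where
  open SpanningTreeDecomposition (BreadthFirst.spanningTree G (walk zero))
  ∣lateEnds∣+2≤1+ℓ : ∣ lateEnds ∣ + 2 ≤ suc ℓ
  ∣lateEnds∣+2≤1+ℓ = +-cancelʳ-≤ n′ _ _ (begin
    ∣ lateEnds ∣ + 2 + n′   ≡⟨ +-assoc ∣ lateEnds ∣ 2 n′ ⟩
    ∣ lateEnds ∣ + (2 + n′) ≡⟨ cong (∣ lateEnds ∣ +_) (+-comm 2 n′) ⟩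
    ∣ lateEnds ∣ + (n′ + 2) ≡⟨ +-assoc ∣ lateEnds ∣ n′ 2 ⟨
    ∣ lateEnds ∣ + n′ + 2   ≤⟨ +-monoˡ-≤ 2 ∣lateEnds∣+n′≤edgeCount ⟩
    edgeCount G + 2         ≡⟨ m+2≡n+ℓ ⟩
    suc n′ + ℓ              ≡⟨ cong suc (+-comm n′ ℓ) ⟩
    suc ℓ + n′              ∎)
    where open ≤-Reasoning
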